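{- There exists an infinite family of graphs $G_1,G_2,\dots$ such that $A_b(G_n)-\varphi(G_n)\to\infty$ as $n\to\infty$.
   Context: A (proper) $k$-coloring of $G$ is a map $c:V(G)\to[k]$ with adjacent vertices colored differently, all $k$ colors used; $V_i=c^{ -1}(i)$. A vertex $v$ is a b-vertex if the colors on $v$ and its neighbors are all $k$ colors. The b-chromatic number $\varphi(G)$ is the maximum $k$ such that $G$ has a $k$-coloring in which every color class contains a b-vertex. A coloring is acyclic if $G[V_i\cup V_j]$ is a forest for all $i,j$. A recoloring step applied to $c$ and a color $i$ having no b-vertex recolors every $v\in V_i$ with a color not appearing on $v$ or its neighbors, producing a $(k-1)$-coloring; if both colorings are acyclic it is an acyclic recoloring step. The acyclic b-chromatic number $A_b(G)$ is the maximum number of colors of an acyclic coloring of $G$ to which no acyclic recoloring step can be applied. -}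

module Defs where

open import Data.Nat using (ℕ; suc; _+_; _≤_)
open import Data.Fin using (Fin; zero; suc; inject₁; fromℕ)
open import Data.Bool using (Bool; true; false)
open import Data.Product using (Σ; ∃; _×_; _,_)
open import Data.Sum using (_⊎_)
open import Relation.Nullary using (¬_)
open import Relation.Binary.PropositionalEquality using (_≡_; _≢_)
open import Function.Definitions using (Injective)

record Graph : Set where
  field
    order  : ℕ
    adj    : Fin order → Fin order → Bool
    symm   : ∀ u v → adj u v ≡ adj v u
    irrefl : ∀ v → adj v v ≡ false

open Graph public

Adj : (G : Graph) → Fin (order G) → Fin (order G) → Set
Adj G u v = adj G u v ≡ true

ColourMap : Graph → ℕ → Set
ColourMap G k = Fin (order G) → Fin k

Proper : (G : Graph) {k : ℕ} → ColourMap G k → Set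
Proper G c = ∀ u v → Adj G u v → c u ≢ c v

IsColouring : (G : Graph) (k : ℕ) → ColourMap G k → Set
IsColouring G k c = Proper G c × (∀ (i : Fin k) → ∃ λ v → c v ≡ i)

IsBVertex : (G : Graph) {k : ℕ} → ColourMap G k → Fin (order G) → Set
IsBVertex G {k} c v =
  ∀ (j : Fin k) → c v ≡ j ⊎ (∃ λ u → Adj G v u × c u ≡ j)

HasBVertex : (G : Graph) {k : ℕ} → ColourMap G k → Fin k → Set
HasBVertex G c i = ∃ λ v → c v ≡ i × IsBVertex G c v

IsBColouring : (G : Graph) (k : ℕ) → ColourMap G k → Set
IsBColouring G k c = IsColouring G k c × (∀ i → HasBVertex G c i)

IsBChromaticNumber : Graph → ℕ → Set
IsBChromaticNumber G b =
  (Σ (ColourMap G b) (IsBColouring G b)) ×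
  (∀ k (c : ColourMap G k) → IsBColouring G k c → k ≤ b)

-- A cycle (length ≥ 3, distinct vertices) all of whose vertices satisfy P,
-- i.e. a cycle in the induced subgraph G[P].
-- Vertices f 0, …, f (m+2); edges f i ~ f (i+1) and f (m+2) ~ f 0.
HasCycleIn : (G : Graph) → (Fin (order G) → Set) → Set
HasCycleIn G P =
  ∃ λ (m : ℕ) → Σ (Fin (suc (suc (suc m))) → Fin (order G)) λ f →
    Injective _≡_ _≡_ f ×
    (∀ i → P (f i)) ×
    (∀ (i : Fin (suc (suc m))) → Adj G (f (inject₁ i)) (f (suc i))) ×
    Adj G (f (fromℕ (suc (suc m)))) (f zero)

Acyclic : (G : Graph) {k : ℕ} → ColourMap G k → Set
Acyclic G {k} c =
  ∀ (i j : Fin k) → ¬ HasCycleIn G (λ v → c v ≡ i ⊎ c v ≡ j)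

-- The resulting
-- (k-1)-colouring is represented with colour set [k] ∖ {i} (no renumbering).
IsRecolouringStep : (G : Graph) {k : ℕ} → ColourMap G k → Fin k →
                    ColourMap G k → Set
IsRecolouringStep G c i c' =
  ¬ HasBVertex G c i ×
  (∀ v → c v ≢ i → c' v ≡ c v) ×
  (∀ v → c v ≡ i → c' v ≢ i × (∀ u → Adj G v u → c' v ≢ c u))

AcyclicStepApplicable : (G : Graph) {k : ℕ} → ColourMap G k → Set
AcyclicStepApplicable G {k} c =
  Acyclic G c ×
  (∃ λ (i : Fin k) → ∃ λ (c' : ColourMap G k) →
     IsRecolouringStep G c i c' × Acyclic G c')

IsAbColouring : (G : Graph) (k : ℕ) → ColourMap G k → Set
IsAbColouring G k c =
  IsColouring G k c × Acyclic G c × ¬ AcyclicStepApplicable G c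

IsAcyclicBChromaticNumber : Graph → ℕ → Set
IsAcyclicBChromaticNumber G a =
  (Σ (ColourMap G a) (IsAbColouring G a)) ×
  (∀ k (c : ColourMap G k) → IsAbColouring G k c → k ≤ a)

-- The graphs are the cocktail-party graphs K_{2m} minus a perfect matching.  As
-- complete multipartite graphs with m parts, their b-chromatic number is m: the
-- b-vertices of distinct colour classes must lie in distinct parts.  An acyclic
-- colouring in which only two non-adjacent vertices share a colour has no
-- 2-coloured cycle, so an injective colouring always admits an acyclic recolouring
-- step, whence A_b < 2m.  Conversely, colour the first pair with one colour and all
-- other vertices distinctly: every singleton class x can only be recoloured with the
-- colour of its partner y, which closes the 2-coloured 4-cycle through x, y and the
-- first pair.  So A_b = 2m - 1, and A_b - φ = m - 1.
module Submission where

open import Defs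
open import Data.Nat using (ℕ; zero; suc; _+_; _*_; _≤_; _<_)
open import Data.Nat.Properties
  using (≤-pred; 1+n≰n; m≤n⇒m<n∨m≡n; +-monoˡ-≤; module ≤-Reasoning)
open import Data.Nat.Tactic.RingSolver using (solve-∀)
open import Data.Fin using (Fin; zero; suc; inject₁; fromℕ; punchIn; punchOut)
open import Data.Fin.Properties using (_≟_; suc-injective; injective⇒≤; punchIn-punchOut)
open import Data.Bool using (not; false)
open import Data.Product using (∃; _×_; _,_; proj₁; proj₂)
open import Data.Sum using (_⊎_; inj₁; inj₂)
open import Data.Empty using (⊥; ⊥-elim)
open import Relation.Nullary using (¬_; yes; no; does; contradiction)
open import Relation.Binary.PropositionalEquality
open import Function using (_∘_)
open import Function.Definitions using (Injective)

Surjective′ : ∀ {m n} → (Fin m → Fin n) → Set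
Surjective′ f = ∀ j → ∃ λ i → f i ≡ j

surjective⇒≤ : ∀ {m n} (f : Fin m → Fin n) → Surjective′ f → n ≤ m
surjective⇒≤ {m} {n} f surj = injective⇒≤ {f = section} section-injective
  where
  section : Fin n → Fin m
  section j = proj₁ (surj j)
  section-injective : Injective _≡_ _≡_ section
  section-injective {i} {j} eq =
    trans (sym (proj₂ (surj i))) (trans (cong f eq) (proj₂ (surj j)))

-- If f x ≡ f y with x ≢ y, then f is still surjective after deleting y.
surjective⇒injective : ∀ {n} (f : Fin n → Fin n) → Surjective′ f → Injective _≡_ _≡_ f
surjective⇒injective {suc n} f surj {x} {y} fx≡fy with x ≟ y
... | yes x≡y = x≡y
... | no x≢y = contradiction (surjective⇒≤ (f ∘ punchIn y) restricted-surjective) 1+n≰n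
  where
  preimage≢y : ∀ j → ∃ λ i → i ≢ y × f i ≡ j
  preimage≢y j with surj j
  ... | i , fi≡j with i ≟ y
  ...   | yes refl = x , x≢y , trans fx≡fy fi≡j
  ...   | no i≢y = i , i≢y , fi≡j
  restricted-surjective : Surjective′ (f ∘ punchIn y)
  restricted-surjective j with preimage≢y j
  ... | i , i≢y , fi≡j =
    punchOut (i≢y ∘ sym) , trans (cong f (punchIn-punchOut (i≢y ∘ sym))) fi≡j

module _ (G : Graph) where

  Vertex : Set
  Vertex = Fin (order G)

  Adj-sym : ∀ {u v} → Adj G u v → Adj G v u
  Adj-sym {u} {v} u~v = trans (symm G v u) u~v

  Adj⇒≢ : ∀ {u v} → Adj G u v → u ≢ v
  Adj⇒≢ {u} u~u refl with trans (sym u~u) (irrefl G u)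
  ... | ()

  square⇒cycle : ∀ (P : Vertex → Set) {a b c d} →
    Adj G a b → Adj G b c → Adj G c d → Adj G d a → a ≢ c → b ≢ d →
    P a → P b → P c → P d → HasCycleIn G P
  square⇒cycle P {a} {b} {c} {d} a~b b~c c~d d~a a≢c b≢d Pa Pb Pc Pd =
    1 , f , f-injective , Pf , (λ { zero → a~b ; (suc zero) → b~c ; (suc (suc zero)) → c~d }) , d~a
    where
    f : Fin 4 → Vertex
    f zero = a
    f (suc zero) = b
    f (suc (suc zero)) = c
    f (suc (suc (suc zero))) = d
    Pf : ∀ i → P (f i)
    Pf zero = Pa
    Pf (suc zero) = Pb
    Pf (suc (suc zero)) = Pc
    Pf (suc (suc (suc zero))) = Pd
    f-injective : Injective _≡_ _≡_ f
    f-injective {zero} {zero} _ = refl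
    f-injective {zero} {suc zero} e = contradiction e (Adj⇒≢ a~b)
    f-injective {zero} {suc (suc zero)} e = contradiction e a≢c
    f-injective {zero} {suc (suc (suc zero))} e = contradiction (sym e) (Adj⇒≢ d~a)
    f-injective {suc zero} {zero} e = contradiction (sym e) (Adj⇒≢ a~b)
    f-injective {suc zero} {suc zero} _ = refl
    f-injective {suc zero} {suc (suc zero)} e = contradiction e (Adj⇒≢ b~c)
    f-injective {suc zero} {suc (suc (suc zero))} e = contradiction e b≢d
    f-injective {suc (suc zero)} {zero} e = contradiction (sym e) a≢c
    f-injective {suc (suc zero)} {suc zero} e = contradiction (sym e) (Adj⇒≢ b~c)
    f-injective {suc (suc zero)} {suc (suc zero)} _ = refl
    f-injective {suc (suc zero)} {suc (suc (suc zero))} e = contradiction e (Adj⇒≢ c~d)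
    f-injective {suc (suc (suc zero))} {zero} e = contradiction e (Adj⇒≢ d~a)
    f-injective {suc (suc (suc zero))} {suc zero} e = contradiction (sym e) b≢d
    f-injective {suc (suc (suc zero))} {suc (suc zero)} e = contradiction (sym e) (Adj⇒≢ c~d)
    f-injective {suc (suc (suc zero))} {suc (suc (suc zero))} _ = refl

  twoColouredPath⇒sameColour : ∀ {k} {c : ColourMap G k} → Proper G c →
    ∀ {i j a b d} →
    (c a ≡ i ⊎ c a ≡ j) → (c b ≡ i ⊎ c b ≡ j) → (c d ≡ i ⊎ c d ≡ j) →
    Adj G a b → Adj G b d → c a ≡ c d
  twoColouredPath⇒sameColour _ (inj₁ a) (inj₂ _) (inj₁ d) _ _ = trans a (sym d)
  twoColouredPath⇒sameColour _ (inj₂ a) (inj₁ _) (inj₂ d) _ _ = trans a (sym d)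
  twoColouredPath⇒sameColour ok (inj₁ a) (inj₁ b) _ a~b _ = ⊥-elim (ok _ _ a~b (trans a (sym b)))
  twoColouredPath⇒sameColour ok (inj₂ a) (inj₂ b) _ a~b _ = ⊥-elim (ok _ _ a~b (trans a (sym b)))
  twoColouredPath⇒sameColour ok (inj₁ _) (inj₂ b) (inj₂ d) _ b~d = ⊥-elim (ok _ _ b~d (trans b (sym d)))
  twoColouredPath⇒sameColour ok (inj₂ _) (inj₁ b) (inj₁ d) _ b~d = ⊥-elim (ok _ _ b~d (trans b (sym d)))

  IsPair : Vertex → Vertex → Vertex → Vertex → Set
  IsPair v w x y = (x ≡ v × y ≡ w) ⊎ (x ≡ w × y ≡ v)

  InjectiveExcept : ∀ {k} → ColourMap G k → Vertex → Vertex → Set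
  InjectiveExcept c v w = ∀ {x y} → c x ≡ c y → x ≡ y ⊎ IsPair v w x y

  module _ {k} {c : ColourMap G k} {v w : Vertex}
           (v≁w : ¬ Adj G v w) (c-inj : InjectiveExcept c v w) where

    injectiveExcept⇒proper : Proper G c
    injectiveExcept⇒proper x y x~y cx≡cy with c-inj cx≡cy
    ... | inj₁ x≡y = Adj⇒≢ x~y x≡y
    ... | inj₂ (inj₁ (refl , refl)) = v≁w x~y
    ... | inj₂ (inj₂ (refl , refl)) = v≁w (Adj-sym x~y)

    -- In a 2-coloured cycle f₀ f₁ f₂ f₃ … both {f₀, f₂} and {f₁, f₃} would be {v, w};
    -- a 2-coloured triangle f₀ f₁ f₂ would make v and w adjacent.
    injectiveExcept⇒acyclic : Acyclic G c
    injectiveExcept⇒acyclic i j (m , f , f-inj , coloured , path , closing) =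
      no-cycle m f f-inj coloured path closing
      where
      TwoColoured : Vertex → Set
      TwoColoured x = c x ≡ i ⊎ c x ≡ j

      twoApart⇒pair : ∀ {a b d} → a ≢ d → TwoColoured a → TwoColoured b → TwoColoured d →
                      Adj G a b → Adj G b d → IsPair v w a d
      twoApart⇒pair a≢d ca cb cd a~b b~d
        with c-inj (twoColouredPath⇒sameColour injectiveExcept⇒proper ca cb cd a~b b~d)
      ... | inj₁ a≡d = contradiction a≡d a≢d
      ... | inj₂ pair = pair

      third-in-pair : ∀ {a b d e} → IsPair v w a d → IsPair v w b e → b ≢ a → b ≢ d → ⊥
      third-in-pair (inj₁ (a≡v , _)) (inj₁ (b≡v , _)) b≢a _ = b≢a (trans b≡v (sym a≡v))
      third-in-pair (inj₁ (_ , d≡w)) (inj₂ (b≡w , _)) _ b≢d = b≢d (trans b≡w (sym d≡w))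
      third-in-pair (inj₂ (_ , d≡v)) (inj₁ (b≡v , _)) _ b≢d = b≢d (trans b≡v (sym d≡v))
      third-in-pair (inj₂ (a≡w , _)) (inj₂ (b≡w , _)) b≢a _ = b≢a (trans b≡w (sym a≡w))

      Path : ∀ {m} → (Fin (3 + m) → Vertex) → Set
      Path f = ∀ t → Adj G (f (inject₁ t)) (f (suc t))

      pair₀₂ : ∀ {m} {f : Fin (3 + m) → Vertex} → Injective _≡_ _≡_ f →
               (∀ t → TwoColoured (f t)) → Path f → IsPair v w (f zero) (f (suc (suc zero)))
      pair₀₂ f-inj col path =
        twoApart⇒pair (λ e → contradiction (f-inj e) λ ())
          (col zero) (col (suc zero)) (col (suc (suc zero))) (path zero) (path (suc zero))

      no-cycle : ∀ m (f : Fin (3 + m) → Vertex) → Injective _≡_ _≡_ f →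
        (∀ t → TwoColoured (f t)) → Path f → Adj G (f (fromℕ (2 + m))) (f zero) → ⊥
      no-cycle zero f f-inj col path closing with pair₀₂ f-inj col path
      ... | inj₁ (f₀≡v , f₂≡w) = v≁w (subst₂ (Adj G) f₀≡v f₂≡w (Adj-sym closing))
      ... | inj₂ (f₀≡w , f₂≡v) = v≁w (subst₂ (Adj G) f₂≡v f₀≡w closing)
      no-cycle (suc m) f f-inj col path _ =
        third-in-pair (pair₀₂ f-inj col path)
          (pair₀₂ {f = f ∘ suc} (suc-injective ∘ f-inj) (col ∘ suc) (path ∘ suc))
          (λ e → contradiction (f-inj e) λ ()) (λ e → contradiction (f-inj e) λ ())

  -- Recolouring the class of v with the colour of w leaves v, w as the only collision.
  injective⇒acyclicStepApplicable : ∀ {k} (c : ColourMap G k) →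
    Injective _≡_ _≡_ c → Acyclic G c →
    ∀ {v w} → v ≢ w → ¬ Adj G v w → AcyclicStepApplicable G c
  injective⇒acyclicStepApplicable {k} c c-inj acyclic {v} {w} v≢w v≁w =
    acyclic , c v , c′ , (no-b-vertex , unchanged , recoloured) , injectiveExcept⇒acyclic v≁w c′-inj
    where
    c′ : ColourMap G k
    c′ x with x ≟ v
    ... | yes _ = c w
    ... | no _ = c x

    c′-v : c′ v ≡ c w
    c′-v with v ≟ v
    ... | yes _ = refl
    ... | no v≢v = contradiction refl v≢v

    c′-inj : InjectiveExcept c′ v w
    c′-inj {x} {y} eq with x ≟ v | y ≟ v
    ... | yes x≡v | yes y≡v = inj₁ (trans x≡v (sym y≡v))
    ... | yes x≡v | no _ = inj₂ (inj₁ (x≡v , sym (c-inj eq)))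
    ... | no _ | yes y≡v = inj₂ (inj₂ (c-inj eq , y≡v))
    ... | no _ | no _ = inj₁ (c-inj eq)

    no-b-vertex : ¬ HasBVertex G c (c v)
    no-b-vertex (u , cu≡cv , b-vertex) with c-inj cu≡cv
    ... | refl with b-vertex (c w)
    ...   | inj₁ cu≡cw = v≢w (c-inj cu≡cw)
    ...   | inj₂ (x , u~x , cx≡cw) with c-inj cx≡cw
    ...     | refl = v≁w u~x

    unchanged : ∀ x → c x ≢ c v → c′ x ≡ c x
    unchanged x cx≢cv with x ≟ v
    ... | yes refl = contradiction refl cx≢cv
    ... | no _ = refl

    recoloured : ∀ x → c x ≡ c v → c′ x ≢ c v × (∀ u → Adj G x u → c′ x ≢ c u)
    recoloured x cx≡cv with c-inj cx≡cv
    ... | refl = (λ e → v≢w (sym (c-inj (trans (sym c′-v) e))))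
               , (λ { u v~u e → v≁w (subst (Adj G v) (sym (c-inj (trans (sym c′-v) e))) v~u) })

  abColouring<order : ∀ {k} {c : ColourMap G k} → IsAbColouring G k c →
    ∀ {v w} → v ≢ w → ¬ Adj G v w → k < order G
  abColouring<order {c = c} ((_ , surj) , acyclic , no-step) v≢w v≁w
    with m≤n⇒m<n∨m≡n (surjective⇒≤ c surj)
  ... | inj₁ k<n = k<n
  ... | inj₂ refl = contradiction
          (injective⇒acyclicStepApplicable c (surjective⇒injective c surj) acyclic v≢w v≁w) no-step

completeMultipartite : ∀ {n m} → (Fin n → Fin m) → Graph
completeMultipartite {n} part = record
  { order = n ; adj = λ u v → not (does (part u ≟ part v)) ; symm = symmetric ; irrefl = irreflexive }
  where
  symmetric : ∀ u v → not (does (part u ≟ part v)) ≡ not (does (part v ≟ part u))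
  symmetric u v with part u ≟ part v | part v ≟ part u
  ... | yes _ | yes _ = refl
  ... | no _ | no _ = refl
  ... | yes e | no ne = contradiction (sym e) ne
  ... | no ne | yes e = contradiction (sym e) ne
  irreflexive : ∀ v → not (does (part v ≟ part v)) ≡ false
  irreflexive v with part v ≟ part v
  ... | yes _ = refl
  ... | no ne = contradiction refl ne

module CompleteMultipartite {n m} (part : Fin n → Fin m) where

  G : Graph
  G = completeMultipartite part

  part≢⇒Adj : ∀ {u v} → part u ≢ part v → Adj G u v
  part≢⇒Adj {u} {v} ne with part u ≟ part v
  ... | yes e = contradiction e ne
  ... | no _ = refl

  Adj⇒part≢ : ∀ {u v} → Adj G u v → part u ≢ part v
  Adj⇒part≢ {u} {v} u~v with part u ≟ part v
  Adj⇒part≢ () | yes _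
  ... | no ne = ne

  part-isBColouring : Surjective′ part → IsBColouring G m part
  part-isBColouring surj =
    ((λ _ _ → Adj⇒part≢) , surj) , λ i → proj₁ (surj i) , proj₂ (surj i) , b-vertex i
    where
    b-vertex : ∀ i → IsBVertex G part (proj₁ (surj i))
    b-vertex i j with part (proj₁ (surj i)) ≟ j
    ... | yes e = inj₁ e
    ... | no ne =
      inj₂ (proj₁ (surj j) , part≢⇒Adj (λ e → ne (trans e (proj₂ (surj j)))) , proj₂ (surj j))

  -- A b-vertex of class i sees colour j outside its own part, so b-vertices of
  -- distinct classes are adjacent and lie in distinct parts.
  bColouring≤parts : ∀ {k} {c : ColourMap G k} → IsBColouring G k c → k ≤ m
  bColouring≤parts {k} {c} ((proper , _) , has-b-vertex) = injective⇒≤ {f = part ∘ b-vertex} injective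
    where
    b-vertex : Fin k → Fin n
    b-vertex i = proj₁ (has-b-vertex i)
    b-vertex-colour : ∀ i → c (b-vertex i) ≡ i
    b-vertex-colour i = proj₁ (proj₂ (has-b-vertex i))
    injective : Injective _≡_ _≡_ (part ∘ b-vertex)
    injective {i} {j} same-part with proj₂ (proj₂ (has-b-vertex i)) j
    ... | inj₁ ci≡j = trans (sym (b-vertex-colour i)) ci≡j
    ... | inj₂ (u , bᵢ~u , cu≡j) =
          contradiction (trans cu≡j (sym (b-vertex-colour j)))
            (proper u (b-vertex j) (part≢⇒Adj λ e → Adj⇒part≢ bᵢ~u (trans same-part (sym e))))

  bChromaticNumber : Surjective′ part → IsBChromaticNumber G m
  bChromaticNumber surj = (part , part-isBColouring surj) , λ _ _ → bColouring≤parts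

-- Vertices 2p and 2p + 1 form pair p.
pairOf : ∀ n → Fin (suc n * 2) → Fin (suc n)
pairOf n zero = zero
pairOf n (suc zero) = zero
pairOf (suc n) (suc (suc v)) = suc (pairOf n v)

pairOf-surjective : ∀ n → Surjective′ (pairOf n)
pairOf-surjective n zero = zero , refl
pairOf-surjective (suc n) (suc p) with pairOf-surjective n p
... | v , pair-v≡p = suc (suc v) , cong suc pair-v≡p

pairOf-suc-suc : ∀ n (v : Fin (n * 2)) → pairOf n (suc (suc v)) ≢ zero
pairOf-suc-suc (suc n) v ()

cocktailParty : ℕ → Graph
cocktailParty n = completeMultipartite (pairOf n)

module CocktailParty (n : ℕ) where
  open CompleteMultipartite (pairOf n)

  firstPair-nonadjacent : ¬ Adj G zero (suc zero)
  firstPair-nonadjacent 0~1 = Adj⇒part≢ {zero} {suc zero} 0~1 refl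

  mergeFirstPair : ColourMap G (suc (n * 2))
  mergeFirstPair zero = zero
  mergeFirstPair (suc v) = v

  mergeFirstPair-injectiveExcept : InjectiveExcept G mergeFirstPair zero (suc zero)
  mergeFirstPair-injectiveExcept {zero} {zero} _ = inj₁ refl
  mergeFirstPair-injectiveExcept {zero} {suc y} e = inj₂ (inj₁ (refl , cong suc (sym e)))
  mergeFirstPair-injectiveExcept {suc x} {zero} e = inj₂ (inj₂ (cong suc e , refl))
  mergeFirstPair-injectiveExcept {suc x} {suc y} e = inj₁ (cong suc e)

  zero-isBVertex : IsBVertex G mergeFirstPair zero
  zero-isBVertex zero = inj₁ refl
  zero-isBVertex (suc j) = inj₂ (suc (suc j) , part≢⇒Adj {zero} (pairOf-suc-suc n j ∘ sym) , refl)

  -- The class of x = i + 2 must move to the colour of the partner y of x, the only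
  -- non-neighbour of x besides itself; then 0, x, 1, y is a 2-coloured 4-cycle.
  recolouring-singleton-creates-square : ∀ i {c′} → IsRecolouringStep G mergeFirstPair (suc i) c′ →
    ¬ Acyclic G c′
  recolouring-singleton-creates-square i {c′} (_ , unchanged , recoloured) acyclic =
    acyclic zero (c′ x)
      (square⇒cycle G Coloured
        (part≢⇒Adj {zero} {x} (pair-x≢0 ∘ sym)) (part≢⇒Adj {x} {suc zero} pair-x≢0)
        (part≢⇒Adj {suc zero} {y} (pair-y≢0 ∘ sym)) (part≢⇒Adj {y} {zero} pair-y≢0)
        (λ ()) x≢y
        (inj₁ (unchanged zero λ ())) (inj₂ refl) (inj₁ (unchanged (suc zero) λ ()))
        (inj₂ (unchanged y (proj₁ (recoloured x refl)))))
    where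
    x y : Fin (suc n * 2)
    x = suc (suc i)
    y = suc (c′ x)
    Coloured : Fin (suc n * 2) → Set
    Coloured v = c′ v ≡ zero ⊎ c′ v ≡ c′ x
    x≢y : x ≢ y
    x≢y x≡y = proj₁ (recoloured x refl) (sym (cong mergeFirstPair x≡y))
    same-pair : pairOf n x ≡ pairOf n y
    same-pair with pairOf n x ≟ pairOf n y
    ... | yes e = e
    ... | no ne = contradiction refl (proj₂ (recoloured x refl) y (part≢⇒Adj ne))
    pair-x≢0 : pairOf n x ≢ zero
    pair-x≢0 = pairOf-suc-suc n i
    pair-y≢0 : pairOf n y ≢ zero
    pair-y≢0 = pair-x≢0 ∘ trans same-pair

  mergeFirstPair-noAcyclicStep : ¬ AcyclicStepApplicable G mergeFirstPair
  mergeFirstPair-noAcyclicStep (_ , zero , _ , (no-b-vertex , _) , _) =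
    no-b-vertex (zero , refl , zero-isBVertex)
  mergeFirstPair-noAcyclicStep (_ , suc i , _ , step , acyclic′) =
    recolouring-singleton-creates-square i step acyclic′

  acyclicBChromaticNumber : IsAcyclicBChromaticNumber G (suc (n * 2))
  acyclicBChromaticNumber =
    (mergeFirstPair , (proper , λ i → suc i , refl) , acyclic , mergeFirstPair-noAcyclicStep) ,
    λ _ _ ab → ≤-pred (abColouring<order G ab {zero} {suc zero} (λ ()) firstPair-nonadjacent)
    where
    proper : Proper G mergeFirstPair
    proper = injectiveExcept⇒proper G firstPair-nonadjacent mergeFirstPair-injectiveExcept
    acyclic : Acyclic G mergeFirstPair
    acyclic = injectiveExcept⇒acyclic G firstPair-nonadjacent mergeFirstPair-injectiveExcept

m≤n⇒m+suc[n]≤suc[n*2] : ∀ {m n} → m ≤ n → m + suc n ≤ suc (n * 2)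
m≤n⇒m+suc[n]≤suc[n*2] {m} {n} m≤n = begin
  m + suc n     ≤⟨ +-monoˡ-≤ (suc n) m≤n ⟩
  n + suc n     ≡⟨ n+suc[n]≡suc[n*2] n ⟩
  suc (n * 2)   ∎
  where
  open ≤-Reasoning
  n+suc[n]≡suc[n*2] : ∀ n → n + suc n ≡ suc (n * 2)
  n+suc[n]≡suc[n*2] = solve-∀

corollary8 : ∃ λ (G : ℕ → Graph) → ∀ (M : ℕ) → ∃ λ (N : ℕ) → ∀ (n : ℕ) → N ≤ n →
    ∃ λ (a : ℕ) → ∃ λ (b : ℕ) →
      IsAcyclicBChromaticNumber (G n) a × IsBChromaticNumber (G n) b × M + b ≤ a
corollary8 = cocktailParty , λ M → M , λ n M≤n →
  suc (n * 2) , suc n ,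
  CocktailParty.acyclicBChromaticNumber n ,
  CompleteMultipartite.bChromaticNumber (pairOf n) (pairOf-surjective n) ,
  m≤n⇒m+suc[n]≤suc[n*2] M≤n
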